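{- Let $d\ge1$, $n\ge1$. The number $c_1(Q)$ of $1$-dimensional cuboctahedra in any $d$-dimensional latin hypercube $Q$ of order $n$ equals $d\,n^{2d-1}(n-1)$.
   Context: A $d$-dimensional latin hypercube of order $n$ is an array $Q=(q_\alpha)$ indexed by $\alpha\in\{0,\ldots,n-1\}^d$ with entries in $\{0,\ldots,n-1\}$ such that any two indices differing in exactly one coordinate carry different symbols. A cuboctahedron in $Q$ is a tuple consisting of $d$ ordered pairs $(a^i_1,a^i_2)$ and $d$ ordered pairs $(b^i_1,b^i_2)$, $i=1,\ldots,d$, of elements of $\{0,\ldots,n-1\}$, such that $q_{a^1_{j_1},\ldots,a^d_{j_d}}=q_{b^1_{j_1},\ldots,b^d_{j_d}}$ for all $j_1,\ldots,j_d\in\{1,2\}$; cuboctahedra are counted as such tuples. It has dimension $k$ if exactly $k$ indices $i$ satisfy $a^i_1\ne a^i_2$ (equivalently $b^i_1\ne b^i_2$). -}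

module Defs where

open import Data.Nat using (ℕ; zero; suc; _+_)
open import Data.Bool using (Bool; true; false; if_then_else_)
open import Data.Fin as Fin using (Fin)
open import Data.Vec using (Vec; []; _∷_; lookup; zipWith)
open import Data.Product using (_×_; _,_; proj₁; proj₂; ∃)
open import Relation.Nullary using (¬_; does)
open import Relation.Binary.PropositionalEquality using (_≡_; _≢_)

Index : ℕ → ℕ → Set
Index d n = Vec (Fin n) d

Array : ℕ → ℕ → Set
Array d n = Index d n → Fin n

DifferInOne : ∀ {d n} → Index d n → Index d n → Set
DifferInOne {d} α β =
  ∃ λ (i : Fin d) → (lookup α i ≢ lookup β i) × (∀ j → j ≢ i → lookup α j ≡ lookup β j)

IsLatinHypercube : ∀ {d n} → Array d n → Set
IsLatinHypercube {d} {n} Q = ∀ (α β : Index d n) → DifferInOne α β → Q α ≢ Q β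

Pairs : ℕ → ℕ → Set
Pairs d n = Vec (Fin n × Fin n) d

-- Candidate cuboctahedron: the a-pairs and the b-pairs.
Tuple : ℕ → ℕ → Set
Tuple d n = Pairs d n × Pairs d n

-- Select x^i_{j_i} for every i; j_i ∈ {1,2} is encoded as false ↦ 1, true ↦ 2.
select : ∀ {d n} → Pairs d n → Vec Bool d → Index d n
select = zipWith (λ p j → if j then proj₂ p else proj₁ p)

IsCuboctahedron : ∀ {d n} → Array d n → Tuple d n → Set
IsCuboctahedron {d} Q (a , b) = ∀ (j : Vec Bool d) → Q (select a j) ≡ Q (select b j)

dim : ∀ {d n} → Pairs d n → ℕ
dim [] = 0
dim ((x , y) ∷ ps) = (if does (x Fin.≟ y) then 0 else 1) + dim ps

-- "The set of k-dimensional cuboctahedra of Q has exactly m elements":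
-- some duplicate-free list enumerates exactly them and has length m.
open import Data.List using (List; length)
open import Data.List.Relation.Unary.Unique.Propositional using (Unique)
open import Data.List.Membership.Propositional using (_∈_)
open import Function.Bundles using (_⇔_)

NumCuboctahedra : ∀ {d n} → Array d n → ℕ → ℕ → Set
NumCuboctahedra {d} {n} Q k m =
  ∃ λ (xs : List (Tuple d n)) →
    Unique xs × (∀ t → (t ∈ xs) ⇔ (IsCuboctahedron Q t × dim (proj₁ t) ≡ k)) × length xs ≡ m

-- In a 1-dimensional cuboctahedron the a-pairs are two distinct points x, y on the
-- axis-parallel line through some u in some direction i.  Every b-pair except the i-th
-- must be degenerate: a non-degenerate one would yield two cells of Q differing in one
-- coordinate and carrying the same symbol.  So the b-pairs are two points on the parallel
-- line through some w, and since Q restricted to that line is a permutation they are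
-- determined by the symbols at x and y.  Cuboctahedra are therefore in bijection with the
-- choices of (i, u, x, y ≠ x, w), of which there are d · n^(d-1) · n(n-1) · n^(d-1).
module Submission where

open import Defs
open import Data.Nat using (ℕ; zero; suc; _+_; _*_; _∸_; _^_; _≤_; s≤s; z≤n)
open import Data.Nat.Properties using (n≮n; suc-injective; +-identityʳ; ^-distribˡ-+-*)
open import Data.Nat.Solver using (module +-*-Solver)
open import Data.Bool using (Bool; true; false; if_then_else_)
open import Data.Fin as Fin using (Fin; punchIn; punchOut; _≟_)
open import Data.Fin.Properties as Finₚ
  using (punchIn-injective; punchInᵢ≢i; punchIn-punchOut; punchOut-injective; any?; injective⇒≤)
open import Data.Vec using (Vec; []; _∷_; lookup; map; insertAt; removeAt; replicate; _[_]≔_)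
open import Data.Vec.Properties
  using (insertAt-lookup; insertAt-punchIn; removeAt-insertAt; ∷-injective; lookup-zipWith;
         lookup-replicate; lookup∘update; lookup∘update′)
import Data.List as List
open List using (List; length; allFin; cartesianProductWith; cartesianProduct)
open import Data.List.Properties using (length-++; length-map; length-tabulate)
open import Data.List.Relation.Unary.All using ([])
open import Data.List.Relation.Unary.AllPairs using ([]; _∷_)
open import Data.List.Relation.Unary.Any using (here)
open import Data.List.Relation.Unary.Unique.Propositional using (Unique)
import Data.List.Relation.Unary.Unique.Propositional.Properties as Unique
open import Data.List.Membership.Propositional using (_∈_)
open import Data.List.Membership.Propositional.Properties
  using (∈-map⁺; ∈-map⁻; ∈-cartesianProductWith⁺; ∈-cartesianProduct⁺; ∈-allFin)
open import Data.Product using (_×_; _,_; proj₁; proj₂; ∃; ∃₂)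
open import Function using (_∘_)
open import Function.Definitions using (Injective; StrictlySurjective)
open import Function.Bundles using (mk⇔)
open import Relation.Nullary using (¬_; yes; no; contradiction)
open import Relation.Binary.PropositionalEquality
  using (_≡_; _≢_; refl; sym; trans; cong; cong₂; subst)

length-cartesianProductWith : ∀ {A B C : Set} (f : A → B → C) (xs : List A) (ys : List B) →
  length (cartesianProductWith f xs ys) ≡ length xs * length ys
length-cartesianProductWith f List.[] ys = refl
length-cartesianProductWith f (x List.∷ xs) ys =
  trans (length-++ (List.map (f x) ys))
        (cong₂ _+_ (length-map (f x) ys) (length-cartesianProductWith f xs ys))

length-cartesianProduct : ∀ {A B : Set} (xs : List A) (ys : List B) →
  length (cartesianProduct xs ys) ≡ length xs * length ys
length-cartesianProduct = length-cartesianProductWith _,_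

length-allFin : ∀ n → length (allFin n) ≡ n
length-allFin n = length-tabulate (λ i → i)

allVecs : ∀ n m → List (Vec (Fin n) m)
allVecs n zero = [] List.∷ List.[]
allVecs n (suc m) = cartesianProductWith _∷_ (allFin n) (allVecs n m)

allVecs-unique : ∀ n m → Unique (allVecs n m)
allVecs-unique n zero = [] ∷ []
allVecs-unique n (suc m) =
  Unique.cartesianProductWith⁺ _∷_ ∷-injective (Unique.allFin⁺ n) (allVecs-unique n m)

∈-allVecs : ∀ {n m} (v : Vec (Fin n) m) → v ∈ allVecs n m
∈-allVecs [] = here refl
∈-allVecs (x ∷ v) = ∈-cartesianProductWith⁺ _∷_ (∈-allFin x) (∈-allVecs v)

length-allVecs : ∀ n m → length (allVecs n m) ≡ n ^ m
length-allVecs n zero = refl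
length-allVecs n (suc m) =
  trans (length-cartesianProductWith _∷_ (allFin n) (allVecs n m))
        (cong₂ _*_ (length-allFin n) (length-allVecs n m))

injective⇒strictlySurjective : ∀ {m} {f : Fin m → Fin m} →
  Injective _≡_ _≡_ f → StrictlySurjective _≡_ f
injective⇒strictlySurjective {suc m} {f} f-inj t with any? (λ z → f z ≟ t)
... | yes hit = hit
... | no miss = contradiction (injective⇒≤ g-inj) (n≮n m)
  where
  f≢t : ∀ z → t ≢ f z
  f≢t z t≡fz = miss (z , sym t≡fz)

  g : Fin (suc m) → Fin m
  g z = punchOut (f≢t z)

  g-inj : Injective _≡_ _≡_ g
  g-inj {a} {b} = f-inj ∘ punchOut-injective (f≢t a) (f≢t b)

offDiagonal : ∀ {n} → Fin (suc n) → Fin n → Fin (suc n) × Fin (suc n)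
offDiagonal x y′ = x , punchIn x y′

Diagonal : ∀ {A : Set} → A × A → Set
Diagonal (x , y) = x ≡ y

offDiagonal-not-diagonal : ∀ {n} (x : Fin (suc n)) y′ → ¬ Diagonal (offDiagonal x y′)
offDiagonal-not-diagonal x y′ = punchInᵢ≢i x y′ ∘ sym

pick : ∀ {A : Set} → A × A → Bool → A
pick p j = if j then proj₂ p else proj₁ p

pick-diagonal : ∀ {A : Set} (z : A) j → pick (z , z) j ≡ z
pick-diagonal z false = refl
pick-diagonal z true = refl

lookup-select : ∀ {m n} (ps : Pairs m n) js k → lookup (select ps js) k ≡ pick (lookup ps k) (lookup js k)
lookup-select ps js k = lookup-zipWith _ k ps js

diagonal : ∀ {A : Set} {m} → Vec A m → Vec (A × A) m
diagonal = map λ z → z , z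

diagonal-injective : ∀ {A : Set} {m} {u u′ : Vec A m} → diagonal u ≡ diagonal u′ → u ≡ u′
diagonal-injective {u = []} {[]} refl = refl
diagonal-injective {u = _ ∷ _} {_ ∷ _} eq with ∷-injective eq
... | refl , tail-eq = cong (_ ∷_) (diagonal-injective tail-eq)

pointwise⇒diagonal : ∀ {m n} (ps : Pairs m n) → (∀ k → Diagonal (lookup ps k)) →
  ∃ λ w → ps ≡ diagonal w
pointwise⇒diagonal [] _ = [] , refl
pointwise⇒diagonal ((x , _) ∷ ps) diag with diag Fin.zero | pointwise⇒diagonal ps (diag ∘ Fin.suc)
... | refl | w , refl = x ∷ w , refl

select-diagonal : ∀ {m n} (u : Vec (Fin n) m) js → select (diagonal u) js ≡ u
select-diagonal [] [] = refl
select-diagonal (z ∷ u) (j ∷ js) = cong₂ _∷_ (pick-diagonal z j) (select-diagonal u js)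

dim-diagonal∷ : ∀ {m n} (z : Fin n) (ps : Pairs m n) → dim ((z , z) ∷ ps) ≡ dim ps
dim-diagonal∷ z ps with z ≟ z
... | yes _ = refl
... | no z≢z = contradiction refl z≢z

dim-diagonal : ∀ {m n} (u : Vec (Fin n) m) → dim (diagonal u) ≡ 0
dim-diagonal [] = refl
dim-diagonal (z ∷ u) = trans (dim-diagonal∷ z (diagonal u)) (dim-diagonal u)

dim≡0⇒diagonal : ∀ {m n} (ps : Pairs m n) → dim ps ≡ 0 → ∃ λ u → ps ≡ diagonal u
dim≡0⇒diagonal [] _ = [] , refl
dim≡0⇒diagonal ((x , y) ∷ ps) h with x ≟ y
... | no _ with () ← h
... | yes refl with dim≡0⇒diagonal ps h
...   | u , refl = x ∷ u , refl

-- The a-pairs of two points on the line through u in direction i; p holds their i-th coordinates.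
axis : ∀ {m n} → Vec (Fin n) m → Fin (suc m) → Fin n × Fin n → Pairs (suc m) n
axis u i p = insertAt (diagonal u) i p

select-axis : ∀ {m n} (u : Vec (Fin n) m) i p js → select (axis u i p) js ≡ insertAt u i (pick p (lookup js i))
select-axis u Fin.zero p (j ∷ js) = cong (pick p j ∷_) (select-diagonal u js)
select-axis (z ∷ u) (Fin.suc i) p (j ∷ js) = cong₂ _∷_ (pick-diagonal z j) (select-axis u i p js)

select-axis-update : ∀ {m n} (u : Vec (Fin n) m) i p js {k} → k ≢ i → ∀ β →
  select (axis u i p) (js [ k ]≔ β) ≡ select (axis u i p) js
select-axis-update u i p js k≢i β =
  trans (select-axis u i p (js [ _ ]≔ β))
        (trans (cong (insertAt u i ∘ pick p) (lookup∘update′ (k≢i ∘ sym) js β)) (sym (select-axis u i p js)))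

dim-axis : ∀ {m n} (u : Vec (Fin n) m) i {p} → ¬ Diagonal p → dim (axis u i p) ≡ 1
dim-axis u Fin.zero {x , y} x≢y with x ≟ y
... | yes x≡y = contradiction x≡y x≢y
... | no _ = cong suc (dim-diagonal u)
dim-axis (z ∷ u) (Fin.suc i) x≢y = trans (dim-diagonal∷ z (axis u i _)) (dim-axis u i x≢y)

data AxisView {m n} : Pairs (suc m) n → Set where
  onAxis : ∀ u i {p} → ¬ Diagonal p → AxisView (axis u i p)

dim≡1⇒axis : ∀ {m n} (ps : Pairs (suc m) n) → dim ps ≡ 1 → AxisView ps
dim≡1⇒axis ((x , y) ∷ ps) h with x ≟ y
... | no x≢y with dim≡0⇒diagonal ps (suc-injective h)
...   | u , refl = onAxis u Fin.zero x≢y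
dim≡1⇒axis {zero} ((x , _) ∷ []) h | yes refl with () ← h
dim≡1⇒axis {suc m} ((x , _) ∷ ps) h | yes refl with dim≡1⇒axis ps h
...   | onAxis u i p≢ = onAxis (x ∷ u) (Fin.suc i) p≢

offAxis-diagonal⇒axis : ∀ {m n} (ps : Pairs (suc m) n) i →
  (∀ k → k ≢ i → Diagonal (lookup ps k)) → ∃₂ λ w q → ps ≡ axis w i q
offAxis-diagonal⇒axis (q ∷ ps) Fin.zero diag with pointwise⇒diagonal ps (λ k → diag (Fin.suc k) λ ())
... | w , refl = w , q , refl
offAxis-diagonal⇒axis {suc m} ((x , _) ∷ ps) (Fin.suc i) diag
  with diag Fin.zero (λ ()) | offAxis-diagonal⇒axis ps i (λ k k≢i → diag (Fin.suc k) (k≢i ∘ Finₚ.suc-injective))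
... | refl | w , q , refl = x ∷ w , q , refl

axis-injective : ∀ {m n} (u u′ : Vec (Fin n) m) i i′ {p p′} → ¬ Diagonal p → ¬ Diagonal p′ →
  axis u i p ≡ axis u′ i′ p′ → i ≡ i′ × u ≡ u′ × p ≡ p′
axis-injective u u′ Fin.zero Fin.zero _ _ eq with ∷-injective eq
... | p≡p′ , tail-eq = refl , diagonal-injective tail-eq , p≡p′
axis-injective u (_ ∷ _) Fin.zero (Fin.suc _) p≢ _ eq with ∷-injective eq
... | refl , _ = contradiction refl p≢
axis-injective (_ ∷ _) u′ (Fin.suc _) Fin.zero _ p′≢ eq with ∷-injective eq
... | refl , _ = contradiction refl p′≢
axis-injective (_ ∷ u) (_ ∷ u′) (Fin.suc i) (Fin.suc i′) p≢ p′≢ eq with ∷-injective eq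
... | refl , tail-eq with axis-injective u u′ i i′ p≢ p′≢ tail-eq
...   | refl , refl , refl = refl , refl , refl

axis-injectiveʰ : ∀ {m n} {w w′ : Vec (Fin n) m} i {q q′} → axis w i q ≡ axis w′ i q′ → w ≡ w′
axis-injectiveʰ {w = w} {w′} i {q} {q′} eq = diagonal-injective
  (trans (sym (removeAt-insertAt (diagonal w) i q))
         (trans (cong (λ ps → removeAt ps i) eq) (removeAt-insertAt (diagonal w′) i q′)))

insertAt-differInOne : ∀ {d n} (v : Index d n) i {z z′} → z ≢ z′ →
  DifferInOne (insertAt v i z) (insertAt v i z′)
insertAt-differInOne v i {z} {z′} z≢z′ = i , differ-at-i , agree-off-i
  where
  differ-at-i : lookup (insertAt v i z) i ≢ lookup (insertAt v i z′) i
  differ-at-i eq = z≢z′ (trans (sym (insertAt-lookup v i z)) (trans eq (insertAt-lookup v i z′)))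

  agree-off-i : ∀ j → j ≢ i → lookup (insertAt v i z) j ≡ lookup (insertAt v i z′) j
  agree-off-i j j≢i =
    subst (λ j → lookup (insertAt v i z) j ≡ lookup (insertAt v i z′) j) (punchIn-punchOut i≢j)
          (trans (insertAt-punchIn v i z k) (sym (insertAt-punchIn v i z′ k)))
    where
    i≢j : i ≢ j
    i≢j = j≢i ∘ sym
    k = punchOut i≢j

select-update-differInOne : ∀ {d n} (ps : Pairs d n) js k → ¬ Diagonal (lookup ps k) →
  DifferInOne (select ps (js [ k ]≔ false)) (select ps (js [ k ]≔ true))
select-update-differInOne ps js k not-diag = k , differ-at-k , agree-off-k
  where
  at-k : ∀ β → lookup (select ps (js [ k ]≔ β)) k ≡ pick (lookup ps k) β
  at-k β = trans (lookup-select ps _ k) (cong (pick (lookup ps k)) (lookup∘update k js β))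

  off-k : ∀ {j} β → j ≢ k → lookup (select ps (js [ k ]≔ β)) j ≡ pick (lookup ps j) (lookup js j)
  off-k {j} β j≢k = trans (lookup-select ps _ j) (cong (pick (lookup ps j)) (lookup∘update′ j≢k js β))

  differ-at-k : lookup (select ps (js [ k ]≔ false)) k ≢ lookup (select ps (js [ k ]≔ true)) k
  differ-at-k eq = not-diag (trans (sym (at-k false)) (trans eq (at-k true)))

  agree-off-k : ∀ j → j ≢ k → lookup (select ps (js [ k ]≔ false)) j ≡ lookup (select ps (js [ k ]≔ true)) j
  agree-off-k j j≢k = trans (off-k false j≢k) (sym (off-k true j≢k))

module _ {d n′} {Q : Array (suc d) (suc n′)} (latin : IsLatinHypercube Q) where

  private
    n = suc n′

  line : Vec (Fin n) d → Fin (suc d) → Fin n → Fin n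
  line v i z = Q (insertAt v i z)

  line-injective : ∀ v i → Injective _≡_ _≡_ (line v i)
  line-injective v i {z} {z′} eq with z ≟ z′
  ... | yes z≡z′ = z≡z′
  ... | no z≢z′ = contradiction eq (latin _ _ (insertAt-differInOne v i z≢z′))

  transfer : Vec (Fin n) d → Fin (suc d) → Vec (Fin n) d → Fin n → Fin n
  transfer w i u z = proj₁ (injective⇒strictlySurjective (line-injective w i) (line u i z))

  line-transfer : ∀ w i u z → line w i (transfer w i u z) ≡ line u i z
  line-transfer w i u z = proj₂ (injective⇒strictlySurjective (line-injective w i) (line u i z))

  transferPair : Vec (Fin n) d → Fin (suc d) → Vec (Fin n) d → Fin n × Fin n → Fin n × Fin n
  transferPair w i u (x , y) = transfer w i u x , transfer w i u y

  axis-cuboctahedron : ∀ u w i p q → (∀ β → line u i (pick p β) ≡ line w i (pick q β)) →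
    IsCuboctahedron Q (axis u i p , axis w i q)
  axis-cuboctahedron u w i p q lines js =
    trans (cong Q (select-axis u i p js))
          (trans (lines (lookup js i)) (cong Q (sym (select-axis w i q js))))

  cuboctahedron⇒lines : ∀ u w i p q → IsCuboctahedron Q (axis u i p , axis w i q) →
    ∀ β → line u i (pick p β) ≡ line w i (pick q β)
  cuboctahedron⇒lines u w i p q cub β =
    subst (λ γ → line u i (pick p γ) ≡ line w i (pick q γ)) (lookup-replicate i β)
      (trans (cong Q (sym (select-axis u i p js)))
             (trans (cub js) (cong Q (select-axis w i q js))))
    where js = replicate (suc d) β

  cuboctahedron-offAxis-diagonal : ∀ u i p b → IsCuboctahedron Q (axis u i p , b) →
    ∀ k → k ≢ i → Diagonal (lookup b k)
  cuboctahedron-offAxis-diagonal u i p b cub k k≢i with proj₁ (lookup b k) ≟ proj₂ (lookup b k)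
  ... | yes diag = diag
  ... | no not-diag =
    contradiction same-symbol (latin _ _ (select-update-differInOne b js k not-diag))
    where
    js = replicate (suc d) false
    a-side : ∀ β → Q (select b (js [ k ]≔ β)) ≡ Q (select (axis u i p) js)
    a-side β = trans (sym (cub (js [ k ]≔ β))) (cong Q (select-axis-update u i p js k≢i β))
    same-symbol : Q (select b (js [ k ]≔ false)) ≡ Q (select b (js [ k ]≔ true))
    same-symbol = trans (a-side false) (sym (a-side true))

  Params : Set
  Params = Fin (suc d) × Vec (Fin n) d × Fin n × Fin n′ × Vec (Fin n) d

  cuboctahedron : Params → Tuple (suc d) n
  cuboctahedron (i , u , x , y′ , w) =
    axis u i (offDiagonal x y′) , axis w i (transferPair w i u (offDiagonal x y′))

  cuboctahedron-sound : ∀ p → IsCuboctahedron Q (cuboctahedron p) × dim (proj₁ (cuboctahedron p)) ≡ 1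
  cuboctahedron-sound (i , u , x , y′ , w) =
    axis-cuboctahedron u w i _ _ lines , dim-axis u i (offDiagonal-not-diagonal x y′)
    where
    lines : ∀ β → line u i (pick (offDiagonal x y′) β) ≡ line w i (pick (transferPair w i u (offDiagonal x y′)) β)
    lines false = sym (line-transfer w i u x)
    lines true = sym (line-transfer w i u (punchIn x y′))

  cuboctahedron-complete : ∀ t → IsCuboctahedron Q t → dim (proj₁ t) ≡ 1 → ∃ λ p → t ≡ cuboctahedron p
  cuboctahedron-complete (a , b) cub dim≡1 with dim≡1⇒axis a dim≡1
  ... | onAxis u i {x , y} x≢y
    with offAxis-diagonal⇒axis b i (cuboctahedron-offAxis-diagonal u i (x , y) b cub)
  ...   | w , q , refl =
    (i , u , x , punchOut x≢y , w) ,
    trans (cong (λ q → axis u i (x , y) , axis w i q) q≡transferred)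
          (cong (λ y → axis u i (x , y) , axis w i (transferPair w i u (x , y))) (sym (punchIn-punchOut x≢y)))
    where
    transferred : ∀ β → pick q β ≡ transfer w i u (pick (x , y) β)
    transferred β = line-injective w i
      (trans (sym (cuboctahedron⇒lines u w i (x , y) q cub β)) (sym (line-transfer w i u _)))
    q≡transferred : q ≡ transferPair w i u (x , y)
    q≡transferred = cong₂ _,_ (transferred false) (transferred true)

  cuboctahedron-injective : Injective _≡_ _≡_ cuboctahedron
  cuboctahedron-injective {i , u , x , y′ , w} {i₂ , u₂ , x₂ , y₂′ , w₂} eq
    with axis-injective u u₂ i i₂ (offDiagonal-not-diagonal x y′) (offDiagonal-not-diagonal x₂ y₂′)
           (cong proj₁ eq)
  ... | refl , refl , xy≡xy₂ with cong proj₁ xy≡xy₂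
  ...   | refl with punchIn-injective x y′ y₂′ (cong proj₂ xy≡xy₂) | axis-injectiveʰ i (cong proj₂ eq)
  ...     | refl | refl = refl

  allParams : List Params
  allParams =
    cartesianProduct (allFin (suc d)) (cartesianProduct (allVecs n d)
      (cartesianProduct (allFin n) (cartesianProduct (allFin n′) (allVecs n d))))

  allParams-unique : Unique allParams
  allParams-unique =
    Unique.cartesianProduct⁺ (Unique.allFin⁺ (suc d)) (Unique.cartesianProduct⁺ (allVecs-unique n d)
      (Unique.cartesianProduct⁺ (Unique.allFin⁺ n)
        (Unique.cartesianProduct⁺ (Unique.allFin⁺ n′) (allVecs-unique n d))))

  ∈-allParams : ∀ p → p ∈ allParams
  ∈-allParams (i , u , x , y′ , w) =
    ∈-cartesianProduct⁺ (∈-allFin i) (∈-cartesianProduct⁺ (∈-allVecs u)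
      (∈-cartesianProduct⁺ (∈-allFin x) (∈-cartesianProduct⁺ (∈-allFin y′) (∈-allVecs w))))

  length-allParams : length allParams ≡ suc d * (n ^ d * (n * (n′ * n ^ d)))
  length-allParams =
    trans (length-cartesianProduct (allFin (suc d)) P₁) (cong₂ _*_ (length-allFin (suc d))
    (trans (length-cartesianProduct (allVecs n d) P₂) (cong₂ _*_ (length-allVecs n d)
    (trans (length-cartesianProduct (allFin n) P₃) (cong₂ _*_ (length-allFin n)
    (trans (length-cartesianProduct (allFin n′) (allVecs n d))
           (cong₂ _*_ (length-allFin n′) (length-allVecs n d))))))))
    where
    P₃ = cartesianProduct (allFin n′) (allVecs n d)
    P₂ = cartesianProduct (allFin n) P₃
    P₁ = cartesianProduct (allVecs n d) P₂

  count-rearranged : suc d * (n ^ d * (n * (n′ * n ^ d))) ≡ suc d * n ^ (2 * suc d ∸ 1) * n′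
  count-rearranged rewrite +-identityʳ d | ^-distribˡ-+-* n d (suc d) =
    solve 4 (λ D X N m → D :* (X :* (N :* (m :* X))) := D :* (X :* (N :* X)) :* m)
            refl (suc d) (n ^ d) n n′
    where open +-*-Solver

  numCuboctahedra-dim1 : NumCuboctahedra Q 1 (suc d * n ^ (2 * suc d ∸ 1) * n′)
  numCuboctahedra-dim1 =
    List.map cuboctahedron allParams ,
    Unique.map⁺ cuboctahedron-injective allParams-unique ,
    (λ t → mk⇔ (listed⇒cuboctahedron t) (cuboctahedron⇒listed t)) ,
    trans (length-map cuboctahedron allParams) (trans length-allParams count-rearranged)
    where
    listed⇒cuboctahedron : ∀ t → t ∈ List.map cuboctahedron allParams →
      IsCuboctahedron Q t × dim (proj₁ t) ≡ 1
    listed⇒cuboctahedron t t∈ with ∈-map⁻ cuboctahedron t∈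
    ... | p , _ , refl = cuboctahedron-sound p

    cuboctahedron⇒listed : ∀ t → IsCuboctahedron Q t × dim (proj₁ t) ≡ 1 →
      t ∈ List.map cuboctahedron allParams
    cuboctahedron⇒listed t (cub , dim≡1) with cuboctahedron-complete t cub dim≡1
    ... | p , refl = ∈-map⁺ cuboctahedron (∈-allParams p)

proposition4 : ∀ (d n : ℕ) → 1 ≤ d → 1 ≤ n → (Q : Array d n) → IsLatinHypercube Q →
    NumCuboctahedra Q 1 (d * n ^ (2 * d ∸ 1) * (n ∸ 1))
proposition4 (suc d) (suc n′) (s≤s z≤n) (s≤s z≤n) Q latin = numCuboctahedra-dim1 latin
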